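{- Let $n\geq 4$ be an integer. Then the graph $L(n)$ is Hamilton-connected: for any two distinct vertices $u,v$ of $L(n)$ there is a $u$-$v$ path of length $n(n-1)-1$ in $L(n)$ (i.e., a path from $u$ to $v$ passing through every vertex exactly once).
   Context: Let $n\geq 3$ and $[n]=\{1,2,\dots,n\}$. The graph $B(n)$ has vertex set $\{v : v\subset [n],\ |v|\in\{1,2\}\}$, and two vertices $v,w$ are adjacent iff $v\subset w$ or $w\subset v$. The graph $L(n)$ is the line graph of $B(n)$. Equivalently, the vertices of $L(n)$ are the pairs $[i,ij]:=\{\{i\},\{i,j\}\}$ with $i,j\in[n]$, $i\neq j$ (so $L(n)$ has $n(n-1)$ vertices), and two distinct vertices $[i,ij]$ and $[r,rs]$ are adjacent iff $i=r$ or $\{i,j\}=\{r,s\}$. -}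

module Defs where

open import Data.Nat using (ℕ; _*_; _∸_)
open import Data.Fin using (Fin)
open import Data.Product using (_×_; _,_; proj₁; proj₂)
open import Data.Sum using (_⊎_)
open import Data.List using (List; []; _∷_; length)
open import Data.List.Relation.Unary.All using (All)
open import Data.List.Relation.Unary.Unique.Propositional using (Unique)
open import Data.List.Membership.Propositional using (_∈_)
open import Relation.Binary.PropositionalEquality using (_≡_; _≢_)
open import Relation.Nullary using (¬_)

-- A vertex [i, ij] of L(n) is encoded as the ordered pair (i , j) with i ≢ j.
Pair : ℕ → Set
Pair n = Fin n × Fin n

IsVertex : {n : ℕ} → Pair n → Set
IsVertex (i , j) = i ≢ j

SameEdge : {n : ℕ} → Pair n → Pair n → Set
SameEdge (i , j) (r , s) = (i ≡ r × j ≡ s) ⊎ (i ≡ s × j ≡ r)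

Adj : {n : ℕ} → Pair n → Pair n → Set
Adj u v = ¬ (u ≡ v) × (proj₁ u ≡ proj₁ v ⊎ SameEdge u v)

data Chain {n : ℕ} : List (Pair n) → Set where
  []  : Chain []
  [-] : ∀ x → Chain (x ∷ [])
  _∷_ : ∀ {x y xs} → Adj x y → Chain (y ∷ xs) → Chain (x ∷ y ∷ xs)

data StartsWith {A : Set} (a : A) : List A → Set where
  here : ∀ {xs} → StartsWith a (a ∷ xs)

data EndsWith {A : Set} (a : A) : List A → Set where
  one  : EndsWith a (a ∷ [])
  cons : ∀ {x xs} → EndsWith a xs → EndsWith a (x ∷ xs)

-- Its number of vertices is n(n-1), i.e. it has length n(n-1)-1.
HamiltonPath : (n : ℕ) → Pair n → Pair n → List (Pair n) → Set
HamiltonPath n u v p =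
  All IsVertex p × Unique p × (∀ (w : Pair n) → IsVertex w → w ∈ p) ×
  Chain p × StartsWith u p × EndsWith v p × length p ≡ n * (n ∸ 1)

{-# OPTIONS --safe #-}
module Submission where

-- A vertex [i, ij] is the pair (i , j) with head i. The vertices with a common head form a
-- clique, and apart from that clique the only neighbour of x is swap x.
-- We induct on n from L(4), whose Hamilton paths are checked by evaluation. For L(n+1), relabel
-- the ground set so that the new element 0 occurs in neither endpoint, and lift a Hamilton path
-- of L(n) along suc. A Hamilton path meets several heads, so it has a step [i,ij] → [j,ij];
-- replace it by the detour [i,i0], [0,0i], all other [0,0m], [0,0j], [j,j0]. The vertices
-- [m,m0] still missing are inserted one at a time next to an inner vertex [m,mx] of the path:
-- of its two path neighbours at most one is the swap, so the other shares the head m.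

open import Defs
open import Data.Nat using (ℕ; zero; suc; _+_; _*_; _∸_; _<_; _≤_; z≤n; s≤s; _≟_)
open import Data.Nat.Properties using (≤-trans)
open import Data.Nat.Tactic.RingSolver using (solve-∀)
open import Data.Fin using (Fin; zero; suc)
open import Data.Fin.Patterns using (0F; 1F; 2F; 3F)
import Data.Fin.Properties as Finₚ
open import Data.Fin.Permutation using (Permutation′; _⟨$⟩ʳ_; inverseˡ; inverseʳ; flip; transpose; _∘ₚ_)
open import Data.Empty using (⊥-elim)
open import Data.Product using (Σ; ∃; ∃₂; _×_; _,_; proj₁; proj₂; swap)
import Data.Product as Product
open import Data.Product.Properties using (≡-dec)
open import Data.Sum using (_⊎_; inj₁; inj₂)
open import Data.List using (List; []; _∷_; length; _++_; map; allFin; lookup)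
import Data.List.Properties as Listₚ
open import Data.List.Relation.Unary.All as All using (All; []; _∷_)
import Data.List.Relation.Unary.All.Properties as Allₚ
open import Data.List.Relation.Unary.Any using (here; there; any?; index)
import Data.List.Relation.Unary.Any.Properties as Anyₚ
open import Data.List.Relation.Unary.AllPairs using ([]; _∷_; allPairs?)
open import Data.List.Relation.Unary.Linked using (Linked; []; [-]; _∷_)
open import Data.List.Relation.Unary.Linked.Properties using (Linked⇒All)
open import Data.List.Relation.Unary.Unique.Propositional using (Unique)
import Data.List.Relation.Unary.Unique.Propositional.Properties as Uniqueₚ
open import Data.List.Membership.Propositional using (_∈_; _∉_)
import Data.List.Membership.Propositional.Properties as ∈ₚ
open import Data.List.Relation.Binary.Subset.Propositional using (_⊆_)
open import Data.List.Relation.Binary.Permutation.Propositional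
  using (_↭_; ↭-swap; ↭-refl; ↭-sym; ↭-trans; ↭-reflexive; prep; ↭⇒↭ₛ; module PermutationReasoning)
import Data.List.Relation.Binary.Permutation.Propositional.Properties as ↭ₚ
import Data.List.Relation.Binary.Permutation.Setoid.Properties as Setoid↭ₚ
open import Function using (_on_; _∘_; id)
open import Function.Definitions using (Injective)
open import Function.Bundles using (Injection)
open import Function.Properties.Inverse using (↔⇒↣)
open import Relation.Binary.PropositionalEquality
open import Relation.Nullary using (¬_; Dec; yes; no)
open import Relation.Nullary.Decidable using (toWitness; map′; ¬?; _×-dec_; _⊎-dec_; _→-dec_; dec-true; dec-false)

fresh : ∀ {n} (xs : List (Fin n)) → length xs < n → ∃ (_∉ xs)
fresh {n} xs len<n with Finₚ.all? (λ x → any? (x Finₚ.≟_) xs)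
... | no ¬all = Finₚ.¬∀⟶∃¬ n (_∈ xs) (λ x → any? (x Finₚ.≟_) xs) ¬all
... | yes all∈ with Finₚ.pigeonhole len<n (λ x → index (all∈ x))
... | i , j , i<j , same = ⊥-elim (Finₚ.<⇒≢ i<j (begin
  i                          ≡⟨ Anyₚ.lookup-index (all∈ i) ⟩
  lookup xs (index (all∈ i)) ≡⟨ cong (lookup xs) same ⟩
  lookup xs (index (all∈ j)) ≡⟨ Anyₚ.lookup-index (all∈ j) ⟨
  j                          ∎))
  where open ≡-Reasoning

module _ {A : Set} where

  Unique-resp-↭ : {xs ys : List A} → xs ↭ ys → Unique xs → Unique ys
  Unique-resp-↭ xs↭ys = Setoid↭ₚ.Unique-resp-↭ (setoid A) (↭⇒↭ₛ xs↭ys)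

  Unique-++⁻ʳ : ∀ (xs : List A) {ys} → Unique (xs ++ ys) → Unique ys
  Unique-++⁻ʳ []       uq       = uq
  Unique-++⁻ʳ (x ∷ xs) (_ ∷ uq) = Unique-++⁻ʳ xs uq

  ∉-++⇒≢ : ∀ xs {ys} {x y : A} → x ∉ xs ++ ys → y ∈ ys → y ≢ x
  ∉-++⇒≢ xs x∉ y∈ refl = x∉ (∈ₚ.∈-++⁺ʳ xs y∈)

  ∈-∈⇒∃↭ : ∀ {x y : A} {xs} → x ∈ xs → y ∈ xs → x ≢ y → ∃ λ zs → xs ↭ x ∷ y ∷ zs
  ∈-∈⇒∃↭ x∈ y∈ x≢y with ∈ₚ.∈-∃++ x∈
  ... | ys , zs , refl with ↭ₚ.∈-resp-↭ (↭ₚ.shift _ ys zs) y∈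
  ...   | here y≡x  = ⊥-elim (x≢y (sym y≡x))
  ...   | there y∈′ with ∈ₚ.∈-∃++ y∈′
  ...     | ys′ , zs′ , eq =
    ys′ ++ zs′ , ↭-trans (↭ₚ.shift _ ys zs) (prep _ (↭-trans (↭-reflexive eq) (↭ₚ.shift _ ys′ zs′)))

  Linked-≡-on : ∀ {B : Set} (f : A → B) {xs x y} → Linked (_≡_ on f) xs → x ∈ xs → y ∈ xs → f x ≡ f y
  Linked-≡-on f {z ∷ _} linked x∈ y∈ = trans (sym (All.lookup fromZ x∈)) (All.lookup fromZ y∈)
    where fromZ = Linked⇒All trans refl linked

  detour-↭ : ∀ (T F Q : List A) t₁ f₁ f₂ t₂ →
             T ++ (t₁ ∷ f₁ ∷ F ++ f₂ ∷ t₂ ∷ []) ++ Q ↭ (t₁ ∷ t₂ ∷ T) ++ (f₁ ∷ f₂ ∷ F) ++ Q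
  detour-↭ T F Q t₁ f₁ f₂ t₂ = begin
    T ++ (t₁ ∷ f₁ ∷ F ++ f₂ ∷ t₂ ∷ []) ++ Q ≡⟨ Listₚ.++-assoc T _ Q ⟨
    (T ++ t₁ ∷ f₁ ∷ F ++ f₂ ∷ t₂ ∷ []) ++ Q ↭⟨ ↭ₚ.++⁺ʳ Q (↭ₚ.++⁺ˡ T (prep t₁ segment)) ⟩
    (T ++ t₁ ∷ t₂ ∷ f₁ ∷ f₂ ∷ F) ++ Q      ↭⟨ ↭ₚ.++⁺ʳ Q (↭ₚ.shifts T (t₁ ∷ t₂ ∷ [])) ⟩
    (t₁ ∷ t₂ ∷ T ++ f₁ ∷ f₂ ∷ F) ++ Q      ≡⟨ cong (t₁ ∷_) (cong (t₂ ∷_) (Listₚ.++-assoc T _ Q)) ⟩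
    (t₁ ∷ t₂ ∷ T) ++ (f₁ ∷ f₂ ∷ F) ++ Q    ∎
    where
    open PermutationReasoning
    segment : f₁ ∷ F ++ f₂ ∷ t₂ ∷ [] ↭ t₂ ∷ f₁ ∷ f₂ ∷ F
    segment = ↭-trans (prep f₁ (↭ₚ.++-comm F (f₂ ∷ t₂ ∷ []))) (↭ₚ.shift t₂ (f₁ ∷ f₂ ∷ []) F)

  StartsWith-++ : ∀ {u : A} xs {c ys ys′} → StartsWith u (xs ++ c ∷ ys) → StartsWith u (xs ++ c ∷ ys′)
  StartsWith-++ []      here = here
  StartsWith-++ (_ ∷ _) here = here

  EndsWith-++⁻ : ∀ {v : A} xs {y ys} → EndsWith v (xs ++ y ∷ ys) → EndsWith v (y ∷ ys)
  EndsWith-++⁻ []           en        = en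
  EndsWith-++⁻ (_ ∷ [])     (cons en) = en
  EndsWith-++⁻ (_ ∷ x ∷ xs) (cons en) = EndsWith-++⁻ (x ∷ xs) en

  EndsWith-++⁺ : ∀ {v : A} xs {ys} → EndsWith v ys → EndsWith v (xs ++ ys)
  EndsWith-++⁺ []       en = en
  EndsWith-++⁺ (_ ∷ xs) en = cons (EndsWith-++⁺ xs en)

  interior-split : ∀ {u v w : A} {q} → StartsWith u q → EndsWith v q → w ∈ q → w ≢ u → w ≢ v →
                   ∃ λ xs → ∃₂ λ a b → ∃ λ ys → q ≡ xs ++ a ∷ w ∷ b ∷ ys
  interior-split here _  (here refl) w≢u _   = ⊥-elim (w≢u refl)
  interior-split here en (there w∈)  _   w≢v = behind en w∈ w≢v
    where
    behind : ∀ {v w a r} → EndsWith v (a ∷ r) → w ∈ r → w ≢ v →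
             ∃ λ xs → ∃₂ λ a′ b → ∃ λ ys → a ∷ r ≡ xs ++ a′ ∷ w ∷ b ∷ ys
    behind (cons one)            (here refl) w≢v = ⊥-elim (w≢v refl)
    behind {r = _ ∷ _ ∷ _} _     (here refl) _   = [] , _ , _ , _ , refl
    behind {a = a} (cons en) (there w∈)  w≢v with behind en w∈ w≢v
    ... | xs , a′ , b , ys , eq = a ∷ xs , a′ , b , ys , cong (a ∷_) eq

module _ {A B : Set} (f : A → B) where

  StartsWith-map : ∀ {u q} → StartsWith u q → StartsWith (f u) (map f q)
  StartsWith-map here = here

  EndsWith-map : ∀ {v q} → EndsWith v q → EndsWith (f v) (map f q)
  EndsWith-map one       = one
  EndsWith-map (cons en) = cons (EndsWith-map en)

record Walk {n : ℕ} (u v : Pair n) (q : List (Pair n)) : Set where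
  constructor walk
  field
    chain : Chain q
    start : StartsWith u q
    end   : EndsWith v q

record Enumerates (n : ℕ) (q : List (Pair n)) : Set where
  constructor enumerates
  field
    vertices : All IsVertex q
    unique   : Unique q
    complete : ∀ w → IsVertex w → w ∈ q
    count    : length q ≡ n * (n ∸ 1)

HamiltonConnected : ℕ → Set
HamiltonConnected n = (u v : Pair n) → IsVertex u → IsVertex v → u ≢ v → ∃ (HamiltonPath n u v)

module _ {n : ℕ} {u v : Pair n} {q : List (Pair n)} where

  hamiltonPath : Enumerates n q → Walk u v q → HamiltonPath n u v q
  hamiltonPath (enumerates vs uq cp ct) (walk ch st en) = vs , uq , cp , ch , st , en , ct

  HamiltonPath⇒Walk : HamiltonPath n u v q → Walk u v q
  HamiltonPath⇒Walk (_ , _ , _ , ch , st , en , _) = walk ch st en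

  HamiltonPath⇒Enumerates : HamiltonPath n u v q → Enumerates n q
  HamiltonPath⇒Enumerates (vs , uq , cp , _ , _ , _ , ct) = enumerates vs uq cp ct

Enumerates-resp-↭ : ∀ {n} {q r : List (Pair n)} → q ↭ r → Enumerates n q → Enumerates n r
Enumerates-resp-↭ q↭r (enumerates vs uq cp ct) = enumerates
  (↭ₚ.All-resp-↭ q↭r vs) (Unique-resp-↭ q↭r uq) (λ w w∈ → ↭ₚ.∈-resp-↭ q↭r (cp w w∈))
  (trans (sym (↭ₚ.↭-length q↭r)) ct)

module _ {n : ℕ} where

  sameHead⇒Adj : {x y : Pair n} → x ≢ y → proj₁ x ≡ proj₁ y → Adj x y
  sameHead⇒Adj x≢y eq = x≢y , inj₁ eq

  swap-Adj : {x : Pair n} → IsVertex x → Adj x (swap x)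
  swap-Adj x∈ = x∈ ∘ cong proj₁ , inj₂ (inj₂ (refl , refl))

  Adj⇒sameHead⊎swap : {x y : Pair n} → Adj x y → proj₁ x ≡ proj₁ y ⊎ y ≡ swap x
  Adj⇒sameHead⊎swap (_ , inj₁ eq)                 = inj₁ eq
  Adj⇒sameHead⊎swap (_ , inj₂ (inj₁ (eq , _)))    = inj₁ eq
  Adj⇒sameHead⊎swap (_ , inj₂ (inj₂ (eq₁ , eq₂))) = inj₂ (cong₂ _,_ (sym eq₂) (sym eq₁))

  detour-sameHead : ∀ {x y z : Pair n} → x ≢ z → y ≢ z → proj₁ x ≡ proj₁ z → proj₁ y ≡ proj₁ z →
                    Chain (x ∷ z ∷ y ∷ [])
  detour-sameHead x≢z y≢z x~z y~z = sameHead⇒Adj x≢z x~z ∷ sameHead⇒Adj (y≢z ∘ sym) (sym y~z) ∷ [-] _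

  Chain-++⁻ : ∀ xs {c : Pair n} {ys} → Chain (xs ++ c ∷ ys) → Chain (xs ++ c ∷ []) × Chain (c ∷ ys)
  Chain-++⁻ []           ch       = [-] _ , ch
  Chain-++⁻ (x ∷ [])     (a ∷ ch) = a ∷ [-] _ , ch
  Chain-++⁻ (x ∷ y ∷ xs) (a ∷ ch) = Product.map₁ (a ∷_) (Chain-++⁻ (y ∷ xs) ch)

  Chain-++⁺ : ∀ xs {c : Pair n} {ys} → Chain (xs ++ c ∷ []) → Chain (c ∷ ys) → Chain (xs ++ c ∷ ys)
  Chain-++⁺ []           _        ch  = ch
  Chain-++⁺ (x ∷ [])     (a ∷ _)  ch  = a ∷ ch
  Chain-++⁺ (x ∷ y ∷ xs) (a ∷ ch) ch′ = a ∷ Chain-++⁺ (y ∷ xs) ch ch′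

  crossing : {q : List (Pair n)} → Chain q →
             Linked (_≡_ on proj₁) q ⊎ ∃₂ λ xs a → ∃ λ ys → q ≡ xs ++ a ∷ swap a ∷ ys
  crossing []       = inj₁ []
  crossing ([-] x)  = inj₁ [-]
  crossing {x ∷ _} (x~y ∷ ch) with Adj⇒sameHead⊎swap x~y
  ... | inj₂ refl = inj₂ ([] , x , _ , refl)
  ... | inj₁ eq with crossing ch
  ...   | inj₁ linked              = inj₁ (eq ∷ linked)
  ...   | inj₂ (xs , a , ys , eq′) = inj₂ (x ∷ xs , a , ys , cong (x ∷_) eq′)

crossing-pair : ∀ {n} {p : List (Pair n)} → 1 < n → Enumerates n p → Chain p →
                ∃ λ xs → ∃₂ λ i j → ∃ λ ys → p ≡ xs ++ (i , j) ∷ (j , i) ∷ ys × i ≢ j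
crossing-pair (s≤s (s≤s _)) en ch with crossing ch
... | inj₁ linked = ⊥-elim (Finₚ.0≢1+n (Linked-≡-on proj₁ linked (Enumerates.complete en (0F , 1F) λ ())
                                                               (Enumerates.complete en (1F , 0F) λ ())))
... | inj₂ (xs , a , ys , refl) =
  xs , proj₁ a , proj₂ a , ys , refl , All.lookup (Enumerates.vertices en) (∈ₚ.∈-++⁺ʳ xs (here refl))

-- Inserting vertices into a walk

record Anchor {n : ℕ} (u v : Pair n) (q : List (Pair n)) (z : Pair n) : Set where
  constructor anchor
  field
    vertex   : Pair n
    member   : vertex ∈ q
    ≢start   : vertex ≢ u
    ≢end     : vertex ≢ v
    sameHead : proj₁ vertex ≡ proj₁ z

module _ {n : ℕ} {u v : Pair n} where

  splice : ∀ {q} xs {c d ys} seg → q ≡ xs ++ c ∷ d ∷ ys → Walk u v q → Chain (c ∷ seg ++ d ∷ []) →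
           ∃ λ q′ → Walk u v q′ × q′ ↭ seg ++ q
  splice xs {c} {d} {ys} seg refl (walk ch st en) detour =
    xs ++ c ∷ seg ++ d ∷ ys ,
    walk (Chain-++⁺ xs front (Chain-++⁺ (c ∷ seg) detour (tail back)))
         (StartsWith-++ xs st)
         (EndsWith-++⁺ xs (EndsWith-++⁺ (c ∷ seg) (EndsWith-++⁻ (c ∷ []) (EndsWith-++⁻ xs en)))) ,
    ↭-trans (↭ₚ.++⁺ˡ xs (↭-sym (↭ₚ.shift c seg (d ∷ ys)))) (↭ₚ.shifts xs seg)
    where
    front = proj₁ (Chain-++⁻ xs ch)
    back  = proj₂ (Chain-++⁻ xs ch)
    tail : ∀ {x y : Pair n} {r} → Chain (x ∷ y ∷ r) → Chain (y ∷ r)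
    tail (_ ∷ ch′) = ch′

  insert-anchored : ∀ {q z} → Walk u v q → Unique q → z ∉ q → Anchor u v q z →
                    ∃ λ q′ → Walk u v q′ × q′ ↭ z ∷ q
  insert-anchored {z = z} wk uq z∉q (anchor w w∈q w≢u w≢v w~z)
    with interior-split (Walk.start wk) (Walk.end wk) w∈q w≢u w≢v
  ... | xs , a , b , ys , refl
    with Chain-++⁻ xs (Walk.chain wk) | Unique-++⁻ʳ xs uq
  ... | _ , a~w ∷ w~b ∷ _ | (_ ∷ a≢b ∷ _) ∷ _
    with Adj⇒sameHead⊎swap a~w | Adj⇒sameHead⊎swap w~b
  ... | inj₁ a≈w  | _         =
    splice xs (z ∷ []) refl wk
      (detour-sameHead (∉-++⇒≢ xs z∉q (here refl)) (∉-++⇒≢ xs z∉q (there (here refl))) (trans a≈w w~z) w~z)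
  ... | inj₂ refl | inj₁ w≈b  =
    splice (xs ++ a ∷ []) (z ∷ []) (sym (Listₚ.++-assoc xs (a ∷ []) _)) wk
      (detour-sameHead (∉-++⇒≢ xs z∉q (there (here refl))) (∉-++⇒≢ xs z∉q (there (there (here refl))))
                       w~z (trans (sym w≈b) w~z))
  ... | inj₂ refl | inj₂ refl = ⊥-elim (a≢b refl)

  Anchor-⊆ : ∀ {q q′ z} → q ⊆ q′ → Anchor u v q z → Anchor u v q′ z
  Anchor-⊆ q⊆q′ (anchor w w∈q w≢u w≢v w~z) = anchor w (q⊆q′ w∈q) w≢u w≢v w~z

  insert-all : ∀ {q} zs → Walk u v q → Unique (zs ++ q) → All (Anchor u v q) zs →
               ∃ λ q′ → Walk u v q′ × q′ ↭ zs ++ q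
  insert-all []       wk _         _          = _ , wk , ↭-refl
  insert-all (z ∷ zs) wk (z∉ ∷ uq) (az ∷ azs) with insert-all zs wk uq azs
  ... | q′ , wk′ , q′↭ with insert-anchored wk′ (Unique-resp-↭ (↭-sym q′↭) uq)
                              (λ z∈q′ → All.lookup z∉ (↭ₚ.∈-resp-↭ q′↭ z∈q′) refl)
                              (Anchor-⊆ (λ w∈q → ↭ₚ.∈-resp-↭ (↭-sym q′↭) (∈ₚ.∈-++⁺ʳ zs w∈q)) az)
  ... | q″ , wk″ , q″↭ = q″ , wk″ , ↭-trans q″↭ (prep z q′↭)

-- Relabelling the ground set

mapPair : ∀ {m n} → (Fin m → Fin n) → Pair m → Pair n
mapPair f = Product.map f f

module _ {m n : ℕ} {f : Fin m → Fin n} (f-injective : Injective _≡_ _≡_ f) where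

  mapPair-injective : Injective _≡_ _≡_ (mapPair f)
  mapPair-injective eq = cong₂ _,_ (f-injective (cong proj₁ eq)) (f-injective (cong proj₂ eq))

  mapPair-IsVertex : ∀ {x} → IsVertex x → IsVertex (mapPair f x)
  mapPair-IsVertex x∈ = x∈ ∘ f-injective

  mapPair-Adj : ∀ {x y} → Adj x y → Adj (mapPair f x) (mapPair f y)
  mapPair-Adj (x≢y , inj₁ eq)                 = x≢y ∘ mapPair-injective , inj₁ (cong f eq)
  mapPair-Adj (x≢y , inj₂ (inj₁ (eq₁ , eq₂))) = x≢y ∘ mapPair-injective , inj₂ (inj₁ (cong f eq₁ , cong f eq₂))
  mapPair-Adj (x≢y , inj₂ (inj₂ (eq₁ , eq₂))) = x≢y ∘ mapPair-injective , inj₂ (inj₂ (cong f eq₁ , cong f eq₂))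

  Chain-map : ∀ {q} → Chain q → Chain (map (mapPair f) q)
  Chain-map []         = []
  Chain-map ([-] x)    = [-] _
  Chain-map (adj ∷ ch) = mapPair-Adj adj ∷ Chain-map ch

  Walk-map : ∀ {u v q} → Walk u v q → Walk (mapPair f u) (mapPair f v) (map (mapPair f) q)
  Walk-map (walk ch st en) = walk (Chain-map ch) (StartsWith-map _ st) (EndsWith-map _ en)

⟨$⟩ʳ-injective : ∀ {n} (π : Permutation′ n) → Injective _≡_ _≡_ (π ⟨$⟩ʳ_)
⟨$⟩ʳ-injective π = Injection.injective (↔⇒↣ π)

transpose-matchˡ : ∀ {n} (i j : Fin n) → transpose i j ⟨$⟩ʳ i ≡ j
transpose-matchˡ i j rewrite dec-true (i Finₚ.≟ i) refl = refl

transpose-fix : ∀ {n} {i j k : Fin n} → k ≢ i → k ≢ j → transpose i j ⟨$⟩ʳ k ≡ k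
transpose-fix {i = i} {j} {k} k≢i k≢j rewrite dec-false (k Finₚ.≟ i) k≢i | dec-false (k Finₚ.≟ j) k≢j = refl

relabel : ∀ {n} → Permutation′ n → Pair n → Pair n
relabel π = mapPair (π ⟨$⟩ʳ_)

module _ {n : ℕ} (π : Permutation′ n) where

  relabel⁻¹-relabel : ∀ x → relabel (flip π) (relabel π x) ≡ x
  relabel⁻¹-relabel _ = cong₂ _,_ (inverseˡ π) (inverseˡ π)

  relabel-relabel⁻¹ : ∀ x → relabel π (relabel (flip π) x) ≡ x
  relabel-relabel⁻¹ _ = cong₂ _,_ (inverseʳ π) (inverseʳ π)

Enumerates-relabel : ∀ {n} (π : Permutation′ n) {q} → Enumerates n q → Enumerates n (map (relabel π) q)
Enumerates-relabel π {q} (enumerates vs uq cp ct) = enumerates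
  (Allₚ.map⁺ (All.map (mapPair-IsVertex (⟨$⟩ʳ-injective π)) vs))
  (Uniqueₚ.map⁺ (mapPair-injective (⟨$⟩ʳ-injective π)) uq)
  (λ w w∈ → subst (_∈ _) (relabel-relabel⁻¹ π w)
              (∈ₚ.∈-map⁺ (relabel π) (cp _ (mapPair-IsVertex (⟨$⟩ʳ-injective (flip π)) w∈))))
  (trans (Listₚ.length-map (relabel π) q) ct)

relabel⁻¹-∃HamiltonPath : ∀ {n} (π : Permutation′ n) {u v} →
                          ∃ (HamiltonPath n (relabel π u) (relabel π v)) → ∃ (HamiltonPath n u v)
relabel⁻¹-∃HamiltonPath {n} π {u} {v} (q , hp) = map (relabel (flip π)) q ,
  subst₂ (λ x y → HamiltonPath n x y _) (relabel⁻¹-relabel π u) (relabel⁻¹-relabel π v)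
    (hamiltonPath (Enumerates-relabel (flip π) (HamiltonPath⇒Enumerates hp))
                  (Walk-map (⟨$⟩ʳ-injective (flip π)) (HamiltonPath⇒Walk hp)))

-- From L(n) to L(n+1)

-- L(n+1) has the new ground element 0 and the old ones shifted by suc;
-- toNew m is [m+1, {m+1,0}] and fromNew m is [0, {0,m+1}].
module _ {n : ℕ} where

  lift : Pair n → Pair (suc n)
  lift = mapPair suc

  toNew fromNew : Fin n → Pair (suc n)
  toNew m   = suc m , zero
  fromNew m = zero , suc m

  lift-injective : Injective _≡_ _≡_ lift
  lift-injective = mapPair-injective Finₚ.suc-injective

  toNew-injective : Injective _≡_ _≡_ toNew
  toNew-injective = Finₚ.suc-injective ∘ cong proj₁

  fromNew-injective : Injective _≡_ _≡_ fromNew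
  fromNew-injective = Finₚ.suc-injective ∘ cong proj₂

  fromNew-detour : ∀ {j} k ks {r} → Unique (j ∷ k ∷ ks) → Chain (fromNew j ∷ r) →
                   Chain (fromNew k ∷ map fromNew ks ++ fromNew j ∷ r)
  fromNew-detour k []        ((j≢k ∷ []) ∷ _)            ch = sameHead⇒Adj (j≢k ∘ sym ∘ fromNew-injective) refl ∷ ch
  fromNew-detour k (k′ ∷ ks) ((_ ∷ j≢ks) ∷ (k≢k′ ∷ _) ∷ uq) ch =
    sameHead⇒Adj (k≢k′ ∘ fromNew-injective) refl ∷ fromNew-detour k′ ks (j≢ks ∷ uq) ch

extension-count : ∀ n → n + (n + n * (n ∸ 1)) ≡ suc n * n
extension-count zero    = refl
extension-count (suc k) = solve k
  where
  solve : ∀ k → suc k + (suc k + suc k * k) ≡ suc (suc k) * suc k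
  solve = solve-∀

Enumerates-extend : ∀ {n} {p : List (Pair n)} ks → allFin n ↭ ks → Enumerates n p →
                    Enumerates (suc n) (map toNew ks ++ map fromNew ks ++ map lift p)
Enumerates-extend {n} {p} ks all↭ks (enumerates vs uq cp ct) = enumerates
  (Allₚ.++⁺ (Allₚ.map⁺ (All.universal (λ _ ()) ks))
    (Allₚ.++⁺ (Allₚ.map⁺ (All.universal (λ _ ()) ks)) (Allₚ.map⁺ (All.map (mapPair-IsVertex Finₚ.suc-injective) vs))))
  (Uniqueₚ.++⁺ (Uniqueₚ.map⁺ toNew-injective uks)
    (Uniqueₚ.++⁺ (Uniqueₚ.map⁺ fromNew-injective uks) (Uniqueₚ.map⁺ lift-injective uq) fromNew∉lift) toNew∉rest)
  complete
  count
  where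
  uks : Unique ks
  uks = Unique-resp-↭ all↭ks (Uniqueₚ.allFin⁺ n)

  ∈ks : ∀ m → m ∈ ks
  ∈ks m = ↭ₚ.∈-resp-↭ all↭ks (∈ₚ.∈-allFin m)

  fromNew∉lift : ∀ {w} → ¬ (w ∈ map fromNew ks × w ∈ map lift p)
  fromNew∉lift (w∈F , w∈L) with ∈ₚ.∈-map⁻ fromNew w∈F | ∈ₚ.∈-map⁻ lift w∈L
  ... | _ , _ , refl | _ , _ , ()

  toNew∉rest : ∀ {w} → ¬ (w ∈ map toNew ks × w ∈ map fromNew ks ++ map lift p)
  toNew∉rest (w∈T , w∈R) with ∈ₚ.∈-map⁻ toNew w∈T | ∈ₚ.∈-++⁻ (map fromNew ks) w∈R
  ... | _ , _ , refl | inj₁ w∈F with ∈ₚ.∈-map⁻ fromNew w∈F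
  ...   | _ , _ , ()
  toNew∉rest (w∈T , w∈R) | _ , _ , refl | inj₂ w∈L with ∈ₚ.∈-map⁻ lift w∈L
  ...   | _ , _ , ()

  complete : ∀ w → IsVertex w → w ∈ map toNew ks ++ map fromNew ks ++ map lift p
  complete (zero  , zero)  w∈ = ⊥-elim (w∈ refl)
  complete (zero  , suc m) _  = ∈ₚ.∈-++⁺ʳ (map toNew ks) (∈ₚ.∈-++⁺ˡ (∈ₚ.∈-map⁺ fromNew (∈ks m)))
  complete (suc m , zero)  _  = ∈ₚ.∈-++⁺ˡ (∈ₚ.∈-map⁺ toNew (∈ks m))
  complete (suc i , suc j) w∈ = ∈ₚ.∈-++⁺ʳ (map toNew ks)
    (∈ₚ.∈-++⁺ʳ (map fromNew ks) (∈ₚ.∈-map⁺ lift (cp (i , j) (w∈ ∘ cong suc))))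

  length-ks : ∀ (f : Fin n → Pair (suc n)) → length (map f ks) ≡ n
  length-ks f = trans (Listₚ.length-map f ks) (trans (sym (↭ₚ.↭-length all↭ks)) (Listₚ.length-tabulate id))

  count : length (map toNew ks ++ map fromNew ks ++ map lift p) ≡ suc n * (suc n ∸ 1)
  count = begin
    length (map toNew ks ++ map fromNew ks ++ map lift p)
      ≡⟨ Listₚ.length-++ (map toNew ks) ⟩
    length (map toNew ks) + length (map fromNew ks ++ map lift p)
      ≡⟨ cong (length (map toNew ks) +_) (Listₚ.length-++ (map fromNew ks)) ⟩
    length (map toNew ks) + (length (map fromNew ks) + length (map lift p))
      ≡⟨ cong₂ _+_ (length-ks toNew) (cong₂ _+_ (length-ks fromNew) (trans (Listₚ.length-map lift p) ct)) ⟩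
    n + (n + n * (n ∸ 1))
      ≡⟨ extension-count n ⟩
    suc n * n ∎
    where open ≡-Reasoning

module Extension {n : ℕ} {a b c d : Fin n} {p : List (Pair n)} (3<n : 3 < n)
                 (hp : HamiltonPath n (a , b) (c , d) p)
                 {xs i j ys} (p≡ : p ≡ xs ++ (i , j) ∷ (j , i) ∷ ys)
                 {ms} (all↭ : allFin n ↭ i ∷ j ∷ ms) where

  ks : List (Fin n)
  ks = i ∷ j ∷ ms

  u′ v′ : Pair (suc n)
  u′ = lift (a , b)
  v′ = lift (c , d)

  q₀ : List (Pair (suc n))
  q₀ = map lift p

  enum : Enumerates n p
  enum = HamiltonPath⇒Enumerates hp

  enumR : Enumerates (suc n) (map toNew ks ++ map fromNew ks ++ q₀)
  enumR = Enumerates-extend ks all↭ enum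

  seg : List (Pair (suc n))
  seg = toNew i ∷ fromNew i ∷ map fromNew ms ++ fromNew j ∷ toNew j ∷ []

  detour : Chain (lift (i , j) ∷ seg ++ lift (j , i) ∷ [])
  detour = sameHead⇒Adj (λ ()) refl ∷ swap-Adj (λ ()) ∷
    subst (λ r → Chain (fromNew i ∷ r)) (sym (Listₚ.++-assoc (map fromNew ms) _ _))
      (fromNew-detour i ms (Unique-resp-↭ (↭-swap i j ↭-refl) (Unique-resp-↭ all↭ (Uniqueₚ.allFin⁺ n)))
        (swap-Adj (λ ()) ∷ sameHead⇒Adj (λ ()) refl ∷ [-] _))

  q₀≡ : q₀ ≡ map lift xs ++ lift (i , j) ∷ lift (j , i) ∷ map lift ys
  q₀≡ = trans (cong (map lift) p≡) (Listₚ.map-++ lift xs _)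

  toR : ∀ {q₁} → q₁ ↭ seg ++ q₀ → map toNew ms ++ q₁ ↭ map toNew ks ++ map fromNew ks ++ q₀
  toR q₁↭ = ↭-trans (↭ₚ.++⁺ˡ (map toNew ms) q₁↭)
                    (detour-↭ (map toNew ms) (map fromNew ms) q₀ (toNew i) (fromNew i) (fromNew j) (toNew j))

  anchorAt : ∀ {q₁} → q₁ ↭ seg ++ q₀ → ∀ m → Anchor u′ v′ q₁ (toNew m)
  anchorAt q₁↭ m with fresh (m ∷ b ∷ d ∷ []) 3<n
  ... | x , x∉ = anchor (lift (m , x))
    (↭ₚ.∈-resp-↭ (↭-sym q₁↭) (∈ₚ.∈-++⁺ʳ seg (∈ₚ.∈-map⁺ lift (Enumerates.complete enum (m , x) (x∉ ∘ here ∘ sym)))))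
    (x∉ ∘ there ∘ here ∘ Finₚ.suc-injective ∘ cong proj₂)
    (x∉ ∘ there ∘ there ∘ here ∘ Finₚ.suc-injective ∘ cong proj₂)
    refl

  path : ∃ (HamiltonPath (suc n) u′ v′)
  path with splice (map lift xs) seg q₀≡ (Walk-map Finₚ.suc-injective (HamiltonPath⇒Walk hp)) detour
  ... | q₁ , walk₁ , q₁↭ with insert-all (map toNew ms) walk₁ (Unique-resp-↭ (↭-sym (toR q₁↭)) (Enumerates.unique enumR))
                                         (Allₚ.map⁺ (All.universal (anchorAt q₁↭) ms))
  ... | q₂ , walk₂ , q₂↭ = q₂ , hamiltonPath (Enumerates-resp-↭ (↭-sym (↭-trans q₂↭ (toR q₁↭))) enumR) walk₂

HamiltonPath-extend : ∀ {n} {a b c d : Fin n} {p} → 3 < n → HamiltonPath n (a , b) (c , d) p →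
                      ∃ (HamiltonPath (suc n) (lift (a , b)) (lift (c , d)))
HamiltonPath-extend 3<n hp
  with crossing-pair (≤-trans (s≤s (s≤s z≤n)) 3<n) (HamiltonPath⇒Enumerates hp) (Walk.chain (HamiltonPath⇒Walk hp))
... | xs , i , j , ys , p≡ , i≢j with ∈-∈⇒∃↭ (∈ₚ.∈-allFin i) (∈ₚ.∈-allFin j) i≢j
... | ms , all↭ = Extension.path 3<n hp p≡ all↭

relabel-off-zero : ∀ {n} {t : Fin (suc n)} {x : Pair (suc n)} → proj₁ x ≢ t → proj₂ x ≢ t →
                   ∃ λ x′ → lift x′ ≡ relabel (transpose t zero) x
relabel-off-zero {t = t} {x₁ , x₂} x₁≢t x₂≢t = unlift (σ≢0 x₁≢t) (σ≢0 x₂≢t)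
  where
  σ≢0 : ∀ {y} → y ≢ t → transpose t zero ⟨$⟩ʳ y ≢ zero
  σ≢0 y≢t σy≡0 = y≢t (⟨$⟩ʳ-injective (transpose t zero) (trans σy≡0 (sym (transpose-matchˡ t zero))))
  unlift : ∀ {n} {y₁ y₂ : Fin (suc n)} → y₁ ≢ zero → y₂ ≢ zero → ∃ λ y′ → lift y′ ≡ (y₁ , y₂)
  unlift {y₁ = zero}  y₁≢0 _    = ⊥-elim (y₁≢0 refl)
  unlift {y₂ = zero}  _    y₂≢0 = ⊥-elim (y₂≢0 refl)
  unlift {y₁ = suc y₁} {suc y₂} _ _ = (y₁ , y₂) , refl

HamiltonConnected-suc : ∀ {n} → 4 ≤ n → HamiltonConnected n → HamiltonConnected (suc n)
HamiltonConnected-suc {n} 4≤n hc u@(u₁ , u₂) v@(v₁ , v₂) u∈ v∈ u≢v with fresh (u₁ ∷ u₂ ∷ v₁ ∷ v₂ ∷ []) (s≤s 4≤n)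
... | t , t∉ with relabel-off-zero (t∉ ∘ here ∘ sym) (t∉ ∘ there ∘ here ∘ sym)
                | relabel-off-zero (t∉ ∘ there ∘ there ∘ here ∘ sym) (t∉ ∘ there ∘ there ∘ there ∘ here ∘ sym)
... | u′ , u′↦ | v′ , v′↦ = relabel⁻¹-∃HamiltonPath σ
  (subst₂ (λ x y → ∃ (HamiltonPath (suc n) x y)) u′↦ v′↦ (HamiltonPath-extend 4≤n (proj₂ (hc u′ v′ u′∈ v′∈ u′≢v′))))
  where
  σ = transpose t zero
  u′∈ : IsVertex u′
  u′∈ = subst IsVertex (sym u′↦) (mapPair-IsVertex (⟨$⟩ʳ-injective σ) u∈) ∘ cong suc
  v′∈ : IsVertex v′
  v′∈ = subst IsVertex (sym v′↦) (mapPair-IsVertex (⟨$⟩ʳ-injective σ) v∈) ∘ cong suc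
  u′≢v′ : u′ ≢ v′
  u′≢v′ u′≡v′ = u≢v (mapPair-injective (⟨$⟩ʳ-injective σ) (trans (sym u′↦) (trans (cong lift u′≡v′) v′↦)))

-- The base case and the induction

relabel-to-01 : ∀ {k} (u : Pair (suc (suc k))) → IsVertex u → ∃ λ π → relabel π u ≡ (0F , 1F)
relabel-to-01 (u₁ , u₂) u₁≢u₂ = π₁ ∘ₚ π₂ , cong₂ _,_ 0↦0 (transpose-matchˡ y 1F)
  where
  π₁ = transpose u₁ 0F
  y  = π₁ ⟨$⟩ʳ u₂
  π₂ = transpose y 1F
  y≢0 : y ≢ 0F
  y≢0 y≡0 = u₁≢u₂ (⟨$⟩ʳ-injective π₁ (trans (transpose-matchˡ u₁ 0F) (sym y≡0)))
  0↦0 : π₂ ⟨$⟩ʳ (π₁ ⟨$⟩ʳ u₁) ≡ 0F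
  0↦0 = trans (cong (π₂ ⟨$⟩ʳ_) (transpose-matchˡ u₁ 0F)) (transpose-fix (y≢0 ∘ sym) λ ())

HamiltonConnected-from-01 : ∀ {k} → (∀ v → IsVertex v → (0F , 1F) ≢ v → ∃ (HamiltonPath (suc (suc k)) (0F , 1F) v)) →
                            HamiltonConnected (suc (suc k))
HamiltonConnected-from-01 {k} from-01 u v u∈ v∈ u≢v with relabel-to-01 u u∈
... | π , u↦01 = relabel⁻¹-∃HamiltonPath π
  (subst (λ x → ∃ (HamiltonPath (suc (suc k)) x (relabel π v))) (sym u↦01)
    (from-01 (relabel π v) (mapPair-IsVertex (⟨$⟩ʳ-injective π) v∈)
      (λ 01≡ → u≢v (mapPair-injective (⟨$⟩ʳ-injective π) (trans u↦01 01≡)))))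

module _ {n : ℕ} where

  ∀-Pair? : {P : Pair n → Set} → (∀ x → Dec (P x)) → Dec (∀ x → P x)
  ∀-Pair? P? = map′ (λ f x → f (proj₁ x) (proj₂ x)) (λ f i j → f (i , j))
                    (Finₚ.all? λ i → Finₚ.all? λ j → P? (i , j))

  _≟ᵥ_ : (x y : Pair n) → Dec (x ≡ y)
  _≟ᵥ_ = ≡-dec Finₚ._≟_ Finₚ._≟_

  isVertex? : (w : Pair n) → Dec (IsVertex w)
  isVertex? (i , j) = ¬? (i Finₚ.≟ j)

  adj? : (x y : Pair n) → Dec (Adj x y)
  adj? x@(i , j) y@(r , s) = ¬? (x ≟ᵥ y) ×-dec
    ((i Finₚ.≟ r) ⊎-dec (((i Finₚ.≟ r) ×-dec (j Finₚ.≟ s)) ⊎-dec ((i Finₚ.≟ s) ×-dec (j Finₚ.≟ r))))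

  chain? : (q : List (Pair n)) → Dec (Chain q)
  chain? []          = yes []
  chain? (x ∷ [])    = yes ([-] x)
  chain? (x ∷ y ∷ q) with adj? x y | chain? (y ∷ q)
  ... | yes x~y | yes ch = yes (x~y ∷ ch)
  ... | no ¬x~y | _      = no λ { (x~y ∷ _) → ¬x~y x~y }
  ... | yes _   | no ¬ch = no λ { (_ ∷ ch) → ¬ch ch }

  startsWith? : (u : Pair n) (q : List (Pair n)) → Dec (StartsWith u q)
  startsWith? u []      = no λ ()
  startsWith? u (x ∷ q) with u ≟ᵥ x
  ... | yes refl = yes here
  ... | no u≢x   = no λ { here → u≢x refl }

  endsWith? : (v : Pair n) (q : List (Pair n)) → Dec (EndsWith v q)
  endsWith? v []          = no λ ()
  endsWith? v (x ∷ [])    with v ≟ᵥ x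
  ... | yes refl = yes one
  ... | no v≢x   = no λ { one → v≢x refl ; (cons ()) }
  endsWith? v (x ∷ y ∷ q) with endsWith? v (y ∷ q)
  ... | yes en = yes (cons en)
  ... | no ¬en = no λ { (cons en) → ¬en en }

hamiltonPath? : ∀ n (u v : Pair n) q → Dec (HamiltonPath n u v q)
hamiltonPath? n u v q =
  All.all? isVertex? q ×-dec allPairs? (λ x y → ¬? (x ≟ᵥ y)) q ×-dec
  ∀-Pair? (λ w → isVertex? w →-dec any? (w ≟ᵥ_) q) ×-dec
  chain? q ×-dec startsWith? u q ×-dec endsWith? v q ×-dec length q ≟ n * (n ∸ 1)

path₄ : Pair 4 → List (Pair 4)
path₄ (0F , 2F) = (0F , 1F) ∷ (0F , 3F) ∷ (3F , 0F) ∷ (3F , 2F) ∷ (3F , 1F) ∷ (1F , 3F) ∷ (1F , 0F) ∷ (1F , 2F) ∷ (2F , 1F) ∷ (2F , 3F) ∷ (2F , 0F) ∷ (0F , 2F) ∷ []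
path₄ (0F , 3F) = (0F , 1F) ∷ (0F , 2F) ∷ (2F , 0F) ∷ (2F , 3F) ∷ (2F , 1F) ∷ (1F , 2F) ∷ (1F , 0F) ∷ (1F , 3F) ∷ (3F , 1F) ∷ (3F , 2F) ∷ (3F , 0F) ∷ (0F , 3F) ∷ []
path₄ (1F , 0F) = (0F , 1F) ∷ (0F , 2F) ∷ (0F , 3F) ∷ (3F , 0F) ∷ (3F , 1F) ∷ (3F , 2F) ∷ (2F , 3F) ∷ (2F , 0F) ∷ (2F , 1F) ∷ (1F , 2F) ∷ (1F , 3F) ∷ (1F , 0F) ∷ []
path₄ (1F , 2F) = (0F , 1F) ∷ (0F , 3F) ∷ (0F , 2F) ∷ (2F , 0F) ∷ (2F , 1F) ∷ (2F , 3F) ∷ (3F , 2F) ∷ (3F , 0F) ∷ (3F , 1F) ∷ (1F , 3F) ∷ (1F , 0F) ∷ (1F , 2F) ∷ []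
path₄ (1F , 3F) = (0F , 1F) ∷ (0F , 2F) ∷ (0F , 3F) ∷ (3F , 0F) ∷ (3F , 1F) ∷ (3F , 2F) ∷ (2F , 3F) ∷ (2F , 0F) ∷ (2F , 1F) ∷ (1F , 2F) ∷ (1F , 0F) ∷ (1F , 3F) ∷ []
path₄ (2F , 0F) = (0F , 1F) ∷ (0F , 2F) ∷ (0F , 3F) ∷ (3F , 0F) ∷ (3F , 2F) ∷ (3F , 1F) ∷ (1F , 3F) ∷ (1F , 0F) ∷ (1F , 2F) ∷ (2F , 1F) ∷ (2F , 3F) ∷ (2F , 0F) ∷ []
path₄ (2F , 1F) = (0F , 1F) ∷ (0F , 3F) ∷ (0F , 2F) ∷ (2F , 0F) ∷ (2F , 3F) ∷ (3F , 2F) ∷ (3F , 0F) ∷ (3F , 1F) ∷ (1F , 3F) ∷ (1F , 0F) ∷ (1F , 2F) ∷ (2F , 1F) ∷ []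
path₄ (2F , 3F) = (0F , 1F) ∷ (0F , 2F) ∷ (0F , 3F) ∷ (3F , 0F) ∷ (3F , 2F) ∷ (3F , 1F) ∷ (1F , 3F) ∷ (1F , 0F) ∷ (1F , 2F) ∷ (2F , 1F) ∷ (2F , 0F) ∷ (2F , 3F) ∷ []
path₄ (3F , 0F) = (0F , 1F) ∷ (0F , 3F) ∷ (0F , 2F) ∷ (2F , 0F) ∷ (2F , 3F) ∷ (2F , 1F) ∷ (1F , 2F) ∷ (1F , 0F) ∷ (1F , 3F) ∷ (3F , 1F) ∷ (3F , 2F) ∷ (3F , 0F) ∷ []
path₄ (3F , 1F) = (0F , 1F) ∷ (0F , 2F) ∷ (0F , 3F) ∷ (3F , 0F) ∷ (3F , 2F) ∷ (2F , 3F) ∷ (2F , 0F) ∷ (2F , 1F) ∷ (1F , 2F) ∷ (1F , 0F) ∷ (1F , 3F) ∷ (3F , 1F) ∷ []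
path₄ (3F , 2F) = (0F , 1F) ∷ (0F , 2F) ∷ (0F , 3F) ∷ (3F , 0F) ∷ (3F , 1F) ∷ (1F , 3F) ∷ (1F , 0F) ∷ (1F , 2F) ∷ (2F , 1F) ∷ (2F , 0F) ∷ (2F , 3F) ∷ (3F , 2F) ∷ []
path₄ _         = []

path₄-HamiltonPath : ∀ v → IsVertex v → (0F , 1F) ≢ v → HamiltonPath 4 (0F , 1F) v (path₄ v)
path₄-HamiltonPath = toWitness {a? = ∀-Pair? λ v → isVertex? v →-dec ¬? ((0F , 1F) ≟ᵥ v) →-dec hamiltonPath? 4 (0F , 1F) v (path₄ v)} _

HamiltonConnected₄ : HamiltonConnected 4
HamiltonConnected₄ = HamiltonConnected-from-01 λ v v∈ 01≢v → path₄ v , path₄-HamiltonPath v v∈ 01≢v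

HamiltonConnected-≥4 : ∀ k → HamiltonConnected (4 + k)
HamiltonConnected-≥4 zero    = HamiltonConnected₄
HamiltonConnected-≥4 (suc k) = HamiltonConnected-suc (s≤s (s≤s (s≤s (s≤s z≤n)))) (HamiltonConnected-≥4 k)

theorem2p4 : (n : ℕ) → 4 ≤ n → (u v : Pair n) → IsVertex u → IsVertex v → u ≢ v →
    Σ (List (Pair n)) (λ p → HamiltonPath n u v p)
theorem2p4 .(4 + k) (s≤s (s≤s (s≤s (s≤s {n = k} _)))) = HamiltonConnected-≥4 k
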